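{- Let $n_1, n_2, \dots$ be a sequence of integers greater than $1$, let $m_j = n_1 n_2 \cdots n_j$ for $j \geq 0$ (so $m_0 = 1$), for $i \geq 1$ let $a_i = 0$ if the greatest $j \ge 0$ such that $m_j$ divides $i$ is even and $a_i = 1$ otherwise, and let $U = a_1 a_2 a_3 \cdots$. Then: (1) for every positive integer $n$ and integer $n' \ge 1$ with $m_{n'-1} < n \leq m_{n'}$, $\mathcal P^{(1)}_U(n) \leq n' + 1$; (2) for every $J \geq 1$, if $n = 2 \sum_{j=1}^{J} (m_{2j} - m_{2j-1})$ and $n'$ is such that $m_{n'-1} < n \le m_{n'}$, then $\mathcal P^{(1)}_U(n) \geq \frac{n'+1}{2}$; (3) for every $j \geq 1$, $\mathcal P^{(1)}_U(m_j) = 2$.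
   Context: Two finite words are Abelian equivalent if each letter occurs the same number of times in both. For an infinite word $w$, $\mathcal P^{(1)}_w(n)$ is the number of Abelian equivalence classes among the factors of $w$ of length $n$. -}

module Defs where

open import Data.Nat using (ℕ; zero; suc; _+_; _*_; _∸_; _%_)
open import Data.Nat.Divisibility using (_∣?_)
open import Data.List using (List; map; upTo; filter; length)
open import Data.List.Relation.Unary.Any using (Any)
open import Data.List.Relation.Unary.AllPairs using (AllPairs)
open import Data.Product using (_×_; ∃)
open import Relation.Binary.PropositionalEquality using (_≡_)
open import Relation.Nullary using (¬_; yes; no)
import Data.Nat as ℕ

-- Infinite words over the alphabet ℕ; position 0 is the first letter.
Word : Set
Word = ℕ → ℕ

occ : ℕ → List ℕ → ℕ
occ a u = length (filter (ℕ._≟ a) u)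

_∼ab_ : List ℕ → List ℕ → Set
u ∼ab v = ∀ a → occ a u ≡ occ a v

factor : Word → ℕ → ℕ → List ℕ
factor w i n = map (λ t → w (i + t)) (upTo n)

-- "P^(1)_w(n) = c": there is a list of c starting positions whose length-n
-- factors are pairwise non-Abelian-equivalent, and every length-n factor is
-- Abelian equivalent to one of them (i.e. c = number of Abelian classes).
AbelianComplexity : Word → ℕ → ℕ → Set
AbelianComplexity w n c =
  ∃ λ (L : List ℕ) →
    length L ≡ c
    × AllPairs (λ i j → ¬ (factor w i n ∼ab factor w j n)) L
    × (∀ i → Any (λ k → factor w i n ∼ab factor w k n) L)

-- ns j = n_j (only j ≥ 1 is used); m j = n_1 ⋯ n_j, m 0 = 1
m : (ℕ → ℕ) → ℕ → ℕ
m ns zero = 1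
m ns (suc j) = m ns j * ns (suc j)

-- greatest j ≤ k with m_j ∣ i (m_0 = 1 always divides)
greatestUpTo : (ℕ → ℕ) → ℕ → ℕ → ℕ
greatestUpTo ns i zero = 0
greatestUpTo ns i (suc k) with m ns (suc k) ∣? i
... | yes _ = suc k
... | no _ = greatestUpTo ns i k

-- for i ≥ 1, the greatest j ≥ 0 with m_j ∣ i satisfies j ≤ i
-- (since m_j ≥ 2^j > j), so the search up to i finds it.
a : (ℕ → ℕ) → ℕ → ℕ
a ns i = greatestUpTo ns i i % 2

-- U = a_1 a_2 a_3 ⋯  (U k = a_{k+1})
U : (ℕ → ℕ) → Word
U ns k = a ns (suc k)

S : (ℕ → ℕ) → ℕ → ℕ
S ns zero = 0
S ns (suc J) = S ns J + (m ns (2 * suc J) ∸ m ns (suc (2 * J)))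

-- Let n₁ = ns 1 and U′ = U (shift ns). The letter a_i vanishes unless n₁ ∣ i, and a_(n₁ t) = 1 - a′_t,
-- so U arises from U′ by replacing each letter x with 0^(n₁-1) (1-x). Both words are binary, so two
-- factors are Abelian equivalent exactly when they have the same weight (number of ones), and the
-- weight of a factor of U is the number of multiples of n₁ it meets minus the weight of the factor of
-- U′ made of the corresponding letters. Induction along ns 1, ns 2, … then shows: factors of length
-- m_j have two weights, w and w + 1; for lengths n ≤ m_(L+1) the weights lie in an interval of width
-- L + 1 and all occur before position m_(L+2); and factors of length 2 S_J have weights at least J
-- apart. As a factor's weight changes by at most one when it slides by one position, the last fact
-- yields J + 1 distinct weights.

module Submission where

open import Defs
open import Data.Nat
open import Data.Nat.Properties
open import Data.Nat.Divisibility
open import Data.Nat.DivMod using (m%n<n; m≡m%n+[m/n]*n)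
open import Algebra.Properties.CommutativeSemigroup +-commutativeSemigroup using (interchange; x∙yz≈y∙xz; xy∙z≈xz∙y)
open import Data.Nat.ListAction using (sum)
open import Data.Nat.ListAction.Properties using (sum-++)
open import Data.Nat.Tactic.RingSolver using (solve-∀)
open import Data.Fin using (Fin; toℕ; fromℕ<)
import Data.Fin.Properties as Fin
open import Data.List using (List; []; _∷_; [_]; _∷ʳ_; length; map; upTo; lookup)
open import Data.List.Properties using (map-++; length-map; length-upTo; upTo-∷ʳ)
open import Data.List.Membership.Propositional.Properties using (∈-lookup)
open import Data.List.Relation.Unary.All as All using (All; []; _∷_)
open import Data.List.Relation.Unary.All.Properties using (¬Any⇒All¬; map⁺; applyUpTo⁺₂)
open import Data.List.Relation.Unary.Any as Any using (Any; here; there)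
open import Data.List.Relation.Unary.Any.Properties using (lookup-index)
open import Data.List.Relation.Unary.AllPairs as AllPairs using (AllPairs; []; _∷_)
open import Data.Product using (∃; ∃₂; _×_; _,_; proj₁; proj₂)
open import Data.Sum using (_⊎_; inj₁; inj₂; [_,_]′)
open import Data.Empty using (⊥-elim)
open import Function using (_∘_; id)
open import Relation.Nullary using (¬_; yes; no)
open import Relation.Binary.Definitions using (tri<; tri≈; tri>)
open import Relation.Binary.PropositionalEquality hiding ([_])

Binary : Word → Set
Binary w = ∀ k → w k ≤ 1

weight : Word → ℕ → ℕ → ℕ
weight w k n = sum (factor w k n)

module _ (w : Word) where

  factor-∷ʳ : ∀ k n → factor w k (suc n) ≡ factor w k n ∷ʳ w (k + n)
  factor-∷ʳ k n = trans (cong (map (λ t → w (k + t))) (sym (upTo-∷ʳ n))) (map-++ _ (upTo n) [ n ])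

  weight-suc : ∀ k n → weight w k (suc n) ≡ weight w k n + w (k + n)
  weight-suc k n = begin
    sum (factor w k (suc n))             ≡⟨ cong sum (factor-∷ʳ k n) ⟩
    sum (factor w k n ∷ʳ w (k + n))      ≡⟨ sum-++ (factor w k n) [ w (k + n) ] ⟩
    weight w k n + (w (k + n) + 0)       ≡⟨ cong (weight w k n +_) (+-identityʳ _) ⟩
    weight w k n + w (k + n)             ∎
    where open ≡-Reasoning

  weight-+ : ∀ k n n′ → weight w k (n + n′) ≡ weight w k n + weight w (k + n) n′
  weight-+ k n zero = trans (cong (weight w k) (+-identityʳ n)) (sym (+-identityʳ _))
  weight-+ k n (suc n′) = begin
    weight w k (n + suc n′)                               ≡⟨ cong (weight w k) (+-suc n n′) ⟩
    weight w k (suc (n + n′))                             ≡⟨ weight-suc k (n + n′) ⟩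
    weight w k (n + n′) + w (k + (n + n′))                ≡⟨ cong₂ _+_ (weight-+ k n n′) (cong w (sym (+-assoc k n n′))) ⟩
    weight w k n + weight w (k + n) n′ + w (k + n + n′)   ≡⟨ +-assoc (weight w k n) _ _ ⟩
    weight w k n + (weight w (k + n) n′ + w (k + n + n′)) ≡⟨ cong (weight w k n +_) (sym (weight-suc (k + n) n′)) ⟩
    weight w k n + weight w (k + n) (suc n′)              ∎
    where open ≡-Reasoning

  weight-1 : ∀ k → weight w k 1 ≡ w k
  weight-1 k = trans (+-identityʳ _) (cong w (+-identityʳ k))

  weight-slide : ∀ k n → weight w k n + w (k + n) ≡ w k + weight w (suc k) n
  weight-slide k n = begin
    weight w k n + w (k + n)            ≡⟨ sym (weight-suc k n) ⟩
    weight w k (1 + n)                  ≡⟨ weight-+ k 1 n ⟩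
    weight w k 1 + weight w (k + 1) n   ≡⟨ cong₂ _+_ (weight-1 k) (cong (λ x → weight w x n) (+-comm k 1)) ⟩
    w k + weight w (suc k) n            ∎
    where open ≡-Reasoning

  module _ (binary : Binary w) where

    weight-slideʳ-≤ : ∀ k n → weight w (suc k) n ≤ suc (weight w k n)
    weight-slideʳ-≤ k n = begin
      weight w (suc k) n       ≤⟨ m≤n+m _ (w k) ⟩
      w k + weight w (suc k) n ≡⟨ sym (weight-slide k n) ⟩
      weight w k n + w (k + n) ≤⟨ +-monoʳ-≤ (weight w k n) (binary (k + n)) ⟩
      weight w k n + 1         ≡⟨ +-comm _ 1 ⟩
      suc (weight w k n)       ∎
      where open ≤-Reasoning

    weight-slideˡ-≤ : ∀ k n → weight w k n ≤ suc (weight w (suc k) n)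
    weight-slideˡ-≤ k n = begin
      weight w k n             ≤⟨ m≤m+n _ (w (k + n)) ⟩
      weight w k n + w (k + n) ≡⟨ weight-slide k n ⟩
      w k + weight w (suc k) n ≤⟨ +-monoˡ-≤ _ (binary k) ⟩
      suc (weight w (suc k) n) ∎
      where open ≤-Reasoning

weight≤length : ∀ {w} → Binary w → ∀ k n → weight w k n ≤ n
weight≤length binary k zero = z≤n
weight≤length {w} binary k (suc n) = begin
  weight w k (suc n)        ≡⟨ weight-suc w k n ⟩
  weight w k n + w (k + n)  ≤⟨ +-mono-≤ (weight≤length binary k n) (binary (k + n)) ⟩
  n + 1                     ≡⟨ +-comm n 1 ⟩
  suc n                     ∎
  where open ≤-Reasoning

-- Abelian classes of factors of a binary word

occ-1≡sum : ∀ {xs} → All (_≤ 1) xs → occ 1 xs ≡ sum xs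
occ-1≡sum [] = refl
occ-1≡sum {0 ∷ _} (_ ∷ p) = occ-1≡sum p
occ-1≡sum {1 ∷ _} (_ ∷ p) = cong suc (occ-1≡sum p)
occ-1≡sum {2+ _ ∷ _} (s≤s () ∷ _)

occ-0+sum≡length : ∀ {xs} → All (_≤ 1) xs → occ 0 xs + sum xs ≡ length xs
occ-0+sum≡length [] = refl
occ-0+sum≡length {0 ∷ _} (_ ∷ p) = cong suc (occ-0+sum≡length p)
occ-0+sum≡length {1 ∷ _} (_ ∷ p) = trans (+-suc _ _) (cong suc (occ-0+sum≡length p))
occ-0+sum≡length {2+ _ ∷ _} (s≤s () ∷ _)

occ-2+b≡0 : ∀ b {xs} → All (_≤ 1) xs → occ (2 + b) xs ≡ 0
occ-2+b≡0 b [] = refl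
occ-2+b≡0 b {0 ∷ _} (_ ∷ p) = occ-2+b≡0 b p
occ-2+b≡0 b {1 ∷ _} (_ ∷ p) = occ-2+b≡0 b p
occ-2+b≡0 b {2+ _ ∷ _} (s≤s () ∷ _)

module _ {w : Word} (binary : Binary w) (n : ℕ) where

  private
    factor-binary : ∀ k → All (_≤ 1) (factor w k n)
    factor-binary k = map⁺ (applyUpTo⁺₂ id n (λ t → binary (k + t)))

    occ-1≡weight : ∀ k → occ 1 (factor w k n) ≡ weight w k n
    occ-1≡weight k = occ-1≡sum (factor-binary k)

    occ-0+weight≡n : ∀ k → occ 0 (factor w k n) + weight w k n ≡ n
    occ-0+weight≡n k = begin
      occ 0 (factor w k n) + weight w k n ≡⟨ occ-0+sum≡length (factor-binary k) ⟩
      length (factor w k n)               ≡⟨ length-map _ (upTo n) ⟩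
      length (upTo n)                     ≡⟨ length-upTo n ⟩
      n                                   ∎
      where open ≡-Reasoning

  ∼ab⇒weight≡ : ∀ i j → factor w i n ∼ab factor w j n → weight w i n ≡ weight w j n
  ∼ab⇒weight≡ i j i∼j = trans (sym (occ-1≡weight i)) (trans (i∼j 1) (occ-1≡weight j))

  weight≡⇒∼ab : ∀ i j → weight w i n ≡ weight w j n → factor w i n ∼ab factor w j n
  weight≡⇒∼ab i j eq zero = +-cancelʳ-≡ _ _ _ (begin
    occ 0 (factor w i n) + weight w i n ≡⟨ occ-0+weight≡n i ⟩
    n                                   ≡⟨ sym (occ-0+weight≡n j) ⟩
    occ 0 (factor w j n) + weight w j n ≡⟨ cong (occ 0 (factor w j n) +_) (sym eq) ⟩
    occ 0 (factor w j n) + weight w i n ∎)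
    where open ≡-Reasoning
  weight≡⇒∼ab i j eq (suc zero) = trans (occ-1≡weight i) (trans eq (sym (occ-1≡weight j)))
  weight≡⇒∼ab i j eq (suc (suc b)) = trans (occ-2+b≡0 b (factor-binary i)) (sym (occ-2+b≡0 b (factor-binary j)))

-- Counting weight classes

Distinct : (ℕ → ℕ) → List ℕ → Set
Distinct f = AllPairs (λ x y → f x ≢ f y)

Covers : (ℕ → ℕ) → List ℕ → Set
Covers f L = ∀ k → Any (λ x → f k ≡ f x) L

ValuesWithin : (ℕ → ℕ) → ℕ → Set
ValuesWithin f D = ∃ λ c → ∀ k → f k ≤ c × c ≤ f k + D

Spread : (ℕ → ℕ) → ℕ → Set
Spread f d = ∃₂ λ k₁ k₂ → f k₁ + d ≤ f k₂

TwoValued : (ℕ → ℕ) → Set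
TwoValued f = ∃₂ λ k₀ k₁ → f k₁ ≡ suc (f k₀) × (∀ k → f k ≡ f k₀ ⊎ f k ≡ f k₁)

abelianComplexity-weight : ∀ {w} → Binary w → ∀ n {L} →
  Distinct (λ k → weight w k n) L → Covers (λ k → weight w k n) L → AbelianComplexity w n (length L)
abelianComplexity-weight binary n {L} distinct covers =
  L , refl , AllPairs.map (λ {i} {j} i≁j i∼j → i≁j (∼ab⇒weight≡ binary n i j i∼j)) distinct ,
  λ i → Any.map (λ {j} → weight≡⇒∼ab binary n i j) (covers i)

abelianComplexity-twoValued : ∀ {w} → Binary w → ∀ n → TwoValued (λ k → weight w k n) → AbelianComplexity w n 2
abelianComplexity-twoValued binary n (k₀ , k₁ , w₁≡1+w₀ , two) =
  abelianComplexity-weight binary n {k₀ ∷ k₁ ∷ []}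
    (((λ w₀≡w₁ → 1+n≢n (sym (trans w₀≡w₁ w₁≡1+w₀))) ∷ []) ∷ [] ∷ [])
    (λ k → [ here , there ∘ here ]′ (two k))

module _ (f : ℕ → ℕ) where

  representatives-below : ∀ B → ∃ λ L → Distinct f L × (∀ k → k < B → Any (λ x → f k ≡ f x) L)
  representatives-below zero = [] , [] , λ _ ()
  representatives-below (suc B) with representatives-below B
  ... | L , distinct , covers with Any.any? (λ x → f B ≟ f x) L
  ...   | yes fB∈ = L , distinct , covers′
    where
      covers′ : ∀ k → k < suc B → Any (λ x → f k ≡ f x) L
      covers′ k k<1+B with m<1+n⇒m<n∨m≡n k<1+B
      ... | inj₁ k<B = covers k k<B
      ... | inj₂ refl = fB∈
  ...   | no fB∉ = B ∷ L , ¬Any⇒All¬ L fB∉ ∷ distinct , covers′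
    where
      covers′ : ∀ k → k < suc B → Any (λ x → f k ≡ f x) (B ∷ L)
      covers′ k k<1+B with m<1+n⇒m<n∨m≡n k<1+B
      ... | inj₁ k<B = there (covers k k<B)
      ... | inj₂ refl = here refl

  representatives : ∀ B → (∀ k → ∃ λ k′ → k′ < B × f k′ ≡ f k) → ∃ λ L → Distinct f L × Covers f L
  representatives B attained with representatives-below B
  ... | L , distinct , covers = L , distinct , λ k →
    let (k′ , k′<B , eq) = attained k in Any.map (trans (sym eq)) (covers k′ k′<B)

  distinct-lookup-injective : ∀ {L} → Distinct f L → ∀ {i j} → f (lookup L i) ≡ f (lookup L j) → i ≡ j
  distinct-lookup-injective (_ ∷ _) {Fin.zero} {Fin.zero} _ = refl
  distinct-lookup-injective (fx≢ ∷ _) {Fin.zero} {Fin.suc j} eq = ⊥-elim (All.lookup fx≢ (∈-lookup j) eq)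
  distinct-lookup-injective (fx≢ ∷ _) {Fin.suc i} {Fin.zero} eq = ⊥-elim (All.lookup fx≢ (∈-lookup i) (sym eq))
  distinct-lookup-injective (_ ∷ distinct) {Fin.suc i} {Fin.suc j} eq = cong Fin.suc (distinct-lookup-injective distinct eq)

  -- k ↦ c ∸ f k embeds the distinct values into Fin (1 + D).
  length≤-within : ∀ {L} D → ValuesWithin f D → Distinct f L → length L ≤ suc D
  length≤-within {L} D (c , within) distinct = Fin.injective⇒≤ injective
    where
      gap< : ∀ i → c ∸ f (lookup L i) < suc D
      gap< i = s≤s (m≤n+o⇒m∸n≤o c _ (proj₂ (within _)))
      gap : Fin (length L) → Fin (suc D)
      gap i = fromℕ< (gap< i)
      injective : ∀ {i j} → gap i ≡ gap j → i ≡ j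
      injective {i} {j} eq = distinct-lookup-injective distinct (∸-cancelˡ-≡ (proj₁ (within _)) (proj₁ (within _))
        (trans (sym (Fin.toℕ-fromℕ< (gap< i))) (trans (cong toℕ eq) (Fin.toℕ-fromℕ< (gap< j)))))

  length≥-attained : ∀ {L} lo D → Covers f L → (∀ v → lo ≤ v → v ≤ lo + D → ∃ λ k → f k ≡ v) → suc D ≤ length L
  length≥-attained {L} lo D covers attained = Fin.injective⇒≤ injective
    where
      witness : Fin (suc D) → ℕ
      witness v = proj₁ (attained (lo + toℕ v) (m≤m+n lo _) (+-monoʳ-≤ lo (s≤s⁻¹ (Fin.toℕ<n v))))
      class : Fin (suc D) → Fin (length L)
      class v = Any.index (covers (witness v))
      value : ∀ v → lo + toℕ v ≡ f (lookup L (class v))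
      value v = trans (sym (proj₂ (attained _ _ _))) (lookup-index (covers (witness v)))
      injective : ∀ {v v′} → class v ≡ class v′ → v ≡ v′
      injective {v} {v′} eq = Fin.toℕ-injective (+-cancelˡ-≡ lo _ _
        (trans (value v) (trans (cong (f ∘ lookup L) eq) (sym (value v′)))))

  module _ (up : ∀ k → f (suc k) ≤ suc (f k)) (down : ∀ k → f k ≤ suc (f (suc k))) where

    intermediate-value : ∀ k₁ k₂ v → f k₁ ≤ v → v ≤ f k₂ → ∃ λ k → f k ≡ v
    intermediate-value k₁ k₂ v lo hi with k₁ ≤? k₂
    ... | yes k₁≤k₂ = rising (k₂ ∸ k₁) lo (subst (λ x → v ≤ f x) (sym (m∸n+n≡m k₁≤k₂)) hi)
      where
        rising : ∀ d → f k₁ ≤ v → v ≤ f (d + k₁) → ∃ λ k → f k ≡ v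
        rising zero lo hi = k₁ , ≤-antisym lo hi
        rising (suc d) lo hi with v ≤? f (d + k₁)
        ... | yes v≤ = rising d lo v≤
        ... | no v≰ = suc (d + k₁) , ≤-antisym (≤-trans (up (d + k₁)) (≰⇒> v≰)) hi
    ... | no k₁≰k₂ = falling (k₁ ∸ k₂) (subst (λ x → f x ≤ v) (sym (m∸n+n≡m (<⇒≤ (≰⇒> k₁≰k₂)))) lo) hi
      where
        falling : ∀ d → f (d + k₂) ≤ v → v ≤ f k₂ → ∃ λ k → f k ≡ v
        falling zero lo hi = k₂ , ≤-antisym lo hi
        falling (suc d) lo hi with f (d + k₂) ≤? v
        ... | yes ≤v = falling d ≤v hi
        ... | no ≰v = suc (d + k₂) , ≤-antisym lo (s≤s⁻¹ (≤-trans (≰⇒> ≰v) (down (d + k₂))))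

-- Weights of factors of a binary word move by at most one per step, so they fill an interval.
length≥-spread : ∀ {w} → Binary w → ∀ n {L d} →
  Covers (λ k → weight w k n) L → Spread (λ k → weight w k n) d → suc d ≤ length L
length≥-spread {w} binary n {L} {d} covers (k₁ , k₂ , spread) = length≥-attained f (f k₁) d covers
  λ v lo hi → intermediate-value f (λ k → weight-slideʳ-≤ w binary k n) (λ k → weight-slideˡ-≤ w binary k n)
    k₁ k₂ v lo (≤-trans hi spread)
  where
    f : ℕ → ℕ
    f k = weight w k n

euclid : ∀ k d → 0 < d → ∃₂ λ q t → t < d × k ≡ d * q + t
euclid k d@(suc _) _ = k / d , k % d , m%n<n k d ,
  trans (m≡m%n+[m/n]*n k d) (trans (+-comm (k % d) _) (cong (_+ k % d) (*-comm (k / d) d)))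

euclid-quotient-≤ : ∀ d {t n N t′ M} → t < d → t + n ≡ d * N + t′ → n ≤ d * M → N ≤ M
euclid-quotient-≤ d {t} {n} {N} {t′} {M} t<d t+n≡ n≤dM = s≤s⁻¹ (*-cancelˡ-< d N (suc M) (begin-strict
  d * N       ≤⟨ m≤m+n (d * N) t′ ⟩
  d * N + t′  ≡⟨ sym t+n≡ ⟩
  t + n       <⟨ +-mono-<-≤ t<d n≤dM ⟩
  d + d * M   ≡⟨ sym (*-suc d M) ⟩
  d * suc M   ∎))
  where open ≤-Reasoning

euclid-< : ∀ d {q t M} → t < d → q < M → d * q + t < d * M
euclid-< d {q} {t} {M} t<d q<M = begin-strict
  d * q + t   <⟨ +-monoʳ-< (d * q) t<d ⟩
  d * q + d   ≡⟨ trans (+-comm (d * q) d) (sym (*-suc d q)) ⟩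
  d * suc q   ≤⟨ *-monoʳ-≤ d q<M ⟩
  d * M       ∎
  where open ≤-Reasoning

complements-equal : ∀ {a b x y N} → a + x ≡ N → b + y ≡ N → x ≡ y → a ≡ b
complements-equal {x = x} a+x≡N b+y≡N refl = +-cancelʳ-≡ x _ _ (trans a+x≡N (sym b+y≡N))

complement-within : ∀ {w x c D N} → x ≤ c → c ≤ x + D → N ≤ w + x → w + x ≤ suc N →
  w ≤ (suc N + D) ∸ c × (suc N + D) ∸ c ≤ w + suc D
complement-within {w} {x} {c} {D} {N} x≤c c≤x+D N≤w+x w+x≤1+N = m+n≤o⇒m≤o∸n w (begin
    w + c         ≤⟨ +-monoʳ-≤ w c≤x+D ⟩
    w + (x + D)   ≡⟨ sym (+-assoc w x D) ⟩
    w + x + D     ≤⟨ +-monoˡ-≤ D w+x≤1+N ⟩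
    suc N + D     ∎) ,
  m≤n+o⇒m∸n≤o _ c (begin
    suc N + D         ≡⟨ sym (+-suc N D) ⟩
    N + suc D         ≤⟨ +-monoˡ-≤ (suc D) (≤-trans N≤w+x (+-monoʳ-≤ w x≤c)) ⟩
    w + c + suc D     ≡⟨ +-assoc w c (suc D) ⟩
    w + (c + suc D)   ≡⟨ x∙yz≈y∙xz w c (suc D) ⟩
    c + (w + suc D)   ∎)
  where open ≤-Reasoning

spread-transfer : ∀ {x x′ y y′ A B c e d} →
  x + c ≡ A + y → x′ + c ≡ B + y′ → A + e ≤ B → y + d ≤ y′ → x + (e + d) ≤ x′
spread-transfer {x} {x′} {y} {y′} {A} {B} {c} {e} {d} x+c≡ x′+c≡ A+e≤B y+d≤y′ = +-cancelʳ-≤ c _ _ (begin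
  x + (e + d) + c   ≡⟨ xy∙z≈xz∙y x (e + d) c ⟩
  x + c + (e + d)   ≡⟨ cong (_+ (e + d)) x+c≡ ⟩
  A + y + (e + d)   ≡⟨ interchange A y e d ⟩
  A + e + (y + d)   ≤⟨ +-mono-≤ A+e≤B y+d≤y′ ⟩
  B + y′            ≡⟨ sym x′+c≡ ⟩
  x′ + c            ∎)
  where open ≤-Reasoning

double-pred : ∀ n s → 2 ≤ n → 2 * (pred n + n * s) ≡ n * (2 * s + 1) + (n ∸ 2)
double-pred 1 _ (s≤s ())
double-pred (2+ r) s _ = identity r s
  where
    identity : ∀ r s → 2 * (suc r + 2+ r * s) ≡ 2+ r * (2 * s + 1) + r
    identity = solve-∀

suc-double-pred : ∀ n s → 1 ≤ n → suc (2 * (pred n + n * s)) ≡ n * (2 * s + 1) + pred n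
suc-double-pred (suc r) s _ = identity r s
  where
    identity : ∀ r s → suc (2 * (r + suc r * s)) ≡ suc r * (2 * s + 1) + r
    identity = solve-∀

pred-+-double : ∀ n x → 1 ≤ n → pred n + (2 * (n * x) + 1) ≡ n * suc (2 * x) + 0
pred-+-double (suc r) x _ = identity r x
  where
    identity : ∀ r x → r + (2 * (suc r * x) + 1) ≡ suc r * suc (2 * x) + 0
    identity = solve-∀

-- The mixed radix m and the letters a

Radices : (ℕ → ℕ) → Set
Radices ns = ∀ j → 1 ≤ j → 2 ≤ ns j

shift : (ℕ → ℕ) → ℕ → ℕ
shift ns j = ns (suc j)

module _ {ns : ℕ → ℕ} (radices : Radices ns) where

  Radices-shift : Radices (shift ns)
  Radices-shift j _ = radices (suc j) z<s

  1<n₁ : 1 < ns 1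
  1<n₁ = radices 1 ≤-refl

  0<n₁ : 0 < ns 1
  0<n₁ = <-trans z<s 1<n₁

  n₁-nonZero : NonZero (ns 1)
  n₁-nonZero = >-nonZero 0<n₁

  n₁∸1<n₁ : ns 1 ∸ 1 < ns 1
  n₁∸1<n₁ = m≤pred[n]⇒suc[m]≤n {{n₁-nonZero}} ≤-refl

  j<m : ∀ j → j < m ns j
  j<m zero = z<s
  j<m (suc j) = begin-strict
    suc j             ≤⟨ j<m j ⟩
    m ns j            <⟨ m<m+n (m ns j) (≤-trans z<s (j<m j)) ⟩
    m ns j + m ns j   ≡⟨ cong (m ns j +_) (sym (+-identityʳ (m ns j))) ⟩
    2 * m ns j        ≡⟨ *-comm 2 (m ns j) ⟩
    m ns j * 2        ≤⟨ *-monoʳ-≤ (m ns j) (radices (suc j) z<s) ⟩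
    m ns (suc j)      ∎
    where open ≤-Reasoning

  0<m : ∀ j → 0 < m ns j
  0<m j = ≤-<-trans z≤n (j<m j)

  2*m≤m-suc : ∀ j → 2 * m ns j ≤ m ns (suc j)
  2*m≤m-suc j = subst (_≤ m ns (suc j)) (*-comm (m ns j) 2) (*-monoʳ-≤ (m ns j) (radices (suc j) z<s))

m-suc : ∀ ns j → m ns (suc j) ≡ ns 1 * m (shift ns) j
m-suc ns zero = trans (+-identityʳ (ns 1)) (sym (*-identityʳ (ns 1)))
m-suc ns (suc j) = trans (cong (_* ns (2 + j)) (m-suc ns j)) (*-assoc (ns 1) (m (shift ns) j) (ns (2 + j)))

m-mono-∣ : ∀ ns {j j′} → j ≤ j′ → m ns j ∣ m ns j′
m-mono-∣ ns {j′ = zero} z≤n = ∣-refl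
m-mono-∣ ns {j′ = suc j′} j≤1+j′ with m≤n⇒m<n∨m≡n j≤1+j′
... | inj₁ j<1+j′ = ∣-trans (m-mono-∣ ns (s≤s⁻¹ j<1+j′)) (m∣m*n (ns (suc j′)))
... | inj₂ refl = ∣-refl

m-mono-≤ : ∀ {ns} → Radices ns → ∀ {j j′} → j ≤ j′ → m ns j ≤ m ns j′
m-mono-≤ {ns} radices {j′ = j′} j≤j′ = ∣⇒≤ {{>-nonZero (0<m radices j′)}} (m-mono-∣ ns j≤j′)

m-suc² : ∀ ns j → m ns (2 + j) ≡ ns 1 * (ns 2 * m (shift (shift ns)) j)
m-suc² ns j = trans (m-suc ns (suc j)) (cong (ns 1 *_) (m-suc (shift ns) j))

S-shift² : ∀ ns J → S ns (suc J) ≡ ns 1 * (pred (ns 2) + ns 2 * S (shift (shift ns)) J)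
S-shift² ns zero = begin
  m ns 2 ∸ m ns 1                 ≡⟨ cong₂ _∸_ (m-suc² ns 0) (m-suc ns 0) ⟩
  n₁ * (n₂ * 1) ∸ n₁ * 1          ≡⟨ sym (*-distribˡ-∸ n₁ (n₂ * 1) 1) ⟩
  n₁ * (n₂ * 1 ∸ 1)               ≡⟨ cong (λ x → n₁ * (pred x)) (*-identityʳ n₂) ⟩
  n₁ * pred n₂                    ≡⟨ cong (n₁ *_) (sym (trans (cong (pred n₂ +_) (*-zeroʳ n₂)) (+-identityʳ _))) ⟩
  n₁ * (pred n₂ + n₂ * 0)         ∎
  where
    open ≡-Reasoning
    n₁ = ns 1
    n₂ = ns 2
S-shift² ns (suc J) = begin
  S ns (suc J) + (m ns (2 * (2 + J)) ∸ m ns (suc (2 * suc J)))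
    ≡⟨ cong₂ (λ s i → s + (m ns i ∸ m ns (suc (2 * suc J)))) (S-shift² ns J) (*-suc 2 (suc J)) ⟩
  n₁ * (pred n₂ + n₂ * S″ J) + (m ns (2 + 2 * suc J) ∸ m ns (suc (2 * suc J)))
    ≡⟨ cong (λ i → n₁ * (pred n₂ + n₂ * S″ J) + (m ns (2 + 2 * suc J) ∸ m ns (suc i))) (*-suc 2 J) ⟩
  n₁ * (pred n₂ + n₂ * S″ J) + (m ns (2 + 2 * suc J) ∸ m ns (2 + suc (2 * J)))
    ≡⟨ cong (n₁ * (pred n₂ + n₂ * S″ J) +_) (cong₂ _∸_ (m-suc² ns (2 * suc J)) (m-suc² ns (suc (2 * J)))) ⟩
  n₁ * (pred n₂ + n₂ * S″ J) + (n₁ * (n₂ * X) ∸ n₁ * (n₂ * Y))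
    ≡⟨ cong (n₁ * (pred n₂ + n₂ * S″ J) +_) (sym (trans (cong (n₁ *_) (*-distribˡ-∸ n₂ X Y)) (*-distribˡ-∸ n₁ (n₂ * X) (n₂ * Y)))) ⟩
  n₁ * (pred n₂ + n₂ * S″ J) + n₁ * (n₂ * (X ∸ Y))
    ≡⟨ distrib n₁ n₂ (pred n₂) (S″ J) (X ∸ Y) ⟩
  n₁ * (pred n₂ + n₂ * S″ (suc J))
    ∎
  where
    open ≡-Reasoning
    n₁ = ns 1
    n₂ = ns 2
    S″ = S (shift (shift ns))
    X = m (shift (shift ns)) (2 * suc J)
    Y = m (shift (shift ns)) (suc (2 * J))
    distrib : ∀ n₁ n₂ p s d → n₁ * (p + n₂ * s) + n₁ * (n₂ * d) ≡ n₁ * (p + n₂ * (s + d))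
    distrib = solve-∀

S≤m : ∀ {ns} → Radices ns → ∀ J → S ns J ≤ m ns (2 * J)
S≤m radices zero = z≤n
S≤m {ns} radices (suc J) = begin
  S ns J + (m ns (2 * suc J) ∸ m ns (suc (2 * J)))
    ≤⟨ +-monoˡ-≤ _ (≤-trans (S≤m radices J) (m-mono-≤ radices (n≤1+n (2 * J)))) ⟩
  m ns (suc (2 * J)) + (m ns (2 * suc J) ∸ m ns (suc (2 * J)))
    ≡⟨ m+[n∸m]≡n (m-mono-≤ radices (≤-trans (n≤1+n _) (≤-reflexive (sym (*-suc 2 J))))) ⟩
  m ns (2 * suc J)
    ∎
  where open ≤-Reasoning

m[L]<2*S[J]⇒L≤2*J : ∀ {ns} → Radices ns → ∀ J L → m ns L < 2 * S ns J → L ≤ 2 * J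
m[L]<2*S[J]⇒L≤2*J {ns} radices J L m<2S with L ≤? 2 * J
... | yes L≤2J = L≤2J
... | no L≰2J = ⊥-elim (<⇒≱ m<2S (begin
  2 * S ns J          ≤⟨ *-monoʳ-≤ 2 (S≤m radices J) ⟩
  2 * m ns (2 * J)    ≤⟨ 2*m≤m-suc radices (2 * J) ⟩
  m ns (suc (2 * J))  ≤⟨ m-mono-≤ radices (≰⇒> L≰2J) ⟩
  m ns L              ∎))
  where open ≤-Reasoning

-- g is the exponent of i in the mixed radix m.
record Valuation (ns : ℕ → ℕ) (i g : ℕ) : Set where
  constructor valuation
  field
    m∣i : m ns g ∣ i
    m∤i : ¬ (m ns (suc g) ∣ i)

module _ (ns : ℕ → ℕ) (i : ℕ) where

  greatestUpTo-∣ : ∀ k → m ns (greatestUpTo ns i k) ∣ i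
  greatestUpTo-∣ zero = 1∣ i
  greatestUpTo-∣ (suc k) with m ns (suc k) ∣? i
  ... | yes m∣i = m∣i
  ... | no _ = greatestUpTo-∣ k

  greatestUpTo-greatest : ∀ k {j} → greatestUpTo ns i k < j → j ≤ k → ¬ (m ns j ∣ i)
  greatestUpTo-greatest zero g<j j≤0 = ⊥-elim (<⇒≱ g<j (≤-trans j≤0 z≤n))
  greatestUpTo-greatest (suc k) g<j j≤1+k with m ns (suc k) ∣? i
  ... | yes _ = ⊥-elim (<⇒≱ g<j j≤1+k)
  ... | no m∤i with m≤n⇒m<n∨m≡n j≤1+k
  ...   | inj₁ j<1+k = greatestUpTo-greatest k g<j (s≤s⁻¹ j<1+k)
  ...   | inj₂ refl = m∤i

valuation-greatestUpTo : ∀ {ns} → Radices ns → ∀ {i} → 1 ≤ i → Valuation ns i (greatestUpTo ns i i)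
valuation-greatestUpTo {ns} radices {i} 1≤i = valuation (greatestUpTo-∣ ns i i) m∤i
  where
    g = greatestUpTo ns i i
    m∤i : ¬ (m ns (suc g) ∣ i)
    m∤i m∣i with suc g ≤? i
    ... | yes 1+g≤i = greatestUpTo-greatest ns i i ≤-refl 1+g≤i m∣i
    ... | no 1+g≰i = <⇒≱ (<-trans (≰⇒> 1+g≰i) (j<m radices (suc g))) (∣⇒≤ {{>-nonZero 1≤i}} m∣i)

valuation-unique : ∀ {ns i g g′} → Valuation ns i g → Valuation ns i g′ → g ≡ g′
valuation-unique {ns} {i} {g} {g′} (valuation m∣i m∤i) (valuation m∣i′ m∤i′) with <-cmp g g′
... | tri< g<g′ _ _ = ⊥-elim (m∤i (∣-trans (m-mono-∣ ns g<g′) m∣i′))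
... | tri≈ _ g≡g′ _ = g≡g′
... | tri> _ _ g>g′ = ⊥-elim (m∤i′ (∣-trans (m-mono-∣ ns g>g′) m∣i))

a-valuation : ∀ {ns} → Radices ns → ∀ {i g} → 1 ≤ i → Valuation ns i g → a ns i ≡ g % 2
a-valuation radices 1≤i v = cong (_% 2) (valuation-unique (valuation-greatestUpTo radices 1≤i) v)

valuation-zero : ∀ {ns i} → ¬ (ns 1 ∣ i) → Valuation ns i 0
valuation-zero {ns} {i} n₁∤i = valuation (1∣ i) λ m₁∣i → n₁∤i (subst (_∣ i) (+-identityʳ (ns 1)) m₁∣i)

valuation-shift : ∀ {ns} → Radices ns → ∀ {t g} → Valuation (shift ns) t g → Valuation ns (ns 1 * t) (suc g)
valuation-shift {ns} radices {t} {g} (valuation m∣t m∤t) = valuation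
  (subst (_∣ ns 1 * t) (sym (m-suc ns g)) (*-monoʳ-∣ (ns 1) m∣t))
  λ m∣n₁t → m∤t (*-cancelˡ-∣ (ns 1) {{n₁-nonZero radices}} (subst (_∣ ns 1 * t) (m-suc ns (suc g)) m∣n₁t))

a-nonmultiple : ∀ {ns} → Radices ns → ∀ {i} → ¬ (ns 1 ∣ i) → a ns i ≡ 0
a-nonmultiple {ns} radices {zero} n₁∤0 = ⊥-elim (n₁∤0 (ns 1 ∣0))
a-nonmultiple radices {suc i} n₁∤i = a-valuation radices z<s (valuation-zero n₁∤i)

a-multiple : ∀ {ns} → Radices ns → ∀ {t} → 1 ≤ t → a ns (ns 1 * t) + a (shift ns) t ≡ 1
a-multiple {ns} radices {t} 1≤t = begin
  a ns (ns 1 * t) + a (shift ns) t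
    ≡⟨ cong₂ _+_ (a-valuation radices 1≤n₁t (valuation-shift radices v)) (a-valuation (Radices-shift radices) 1≤t v) ⟩
  suc g % 2 + g % 2
    ≡⟨ successive-parities g ⟩
  1 ∎
  where
    open ≡-Reasoning
    g = greatestUpTo (shift ns) t t
    v = valuation-greatestUpTo (Radices-shift radices) 1≤t
    1≤n₁t : 1 ≤ ns 1 * t
    1≤n₁t = ≤-trans 1≤t (m≤n*m t (ns 1) {{n₁-nonZero radices}})
    successive-parities : ∀ g → suc g % 2 + g % 2 ≡ 1
    successive-parities zero = refl
    successive-parities (suc zero) = refl
    successive-parities (suc (suc g)) = successive-parities g

U-binary : ∀ ns → Binary (U ns)
U-binary ns k = s≤s⁻¹ (m%n<n (greatestUpTo ns (suc k) (suc k)) 2)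

-- U as a substitution image of U (shift ns)

U[0]≡0 : ∀ {ns} → Radices ns → U ns 0 ≡ 0
U[0]≡0 radices = a-nonmultiple radices λ n₁∣1 → <⇒≱ (1<n₁ radices) (∣⇒≤ n₁∣1)

module _ {ns : ℕ → ℕ} (radices : Radices ns) where

  private
    n₁ = ns 1
    ones : ℕ → ℕ
    ones = weight (U ns) 0
    ones′ : ℕ → ℕ
    ones′ = weight (U (shift ns)) 0

  ones-nonmultiple : ∀ b {r} → r < n₁ → ones (n₁ * b + r) ≡ ones (n₁ * b)
  ones-nonmultiple b {zero} _ = cong ones (+-identityʳ (n₁ * b))
  ones-nonmultiple b {suc r} 1+r<n₁ = begin
    ones (n₁ * b + suc r)                        ≡⟨ cong ones (+-suc (n₁ * b) r) ⟩
    ones (suc (n₁ * b + r))                      ≡⟨ weight-suc (U ns) 0 (n₁ * b + r) ⟩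
    ones (n₁ * b + r) + a ns (suc (n₁ * b + r))  ≡⟨ cong₂ _+_ (ones-nonmultiple b (<-trans (n<1+n r) 1+r<n₁)) (a-nonmultiple radices n₁∤) ⟩
    ones (n₁ * b) + 0                            ≡⟨ +-identityʳ _ ⟩
    ones (n₁ * b)                                ∎
    where
      open ≡-Reasoning
      n₁∤ : ¬ (n₁ ∣ suc (n₁ * b + r))
      n₁∤ n₁∣ = <⇒≱ 1+r<n₁ (∣⇒≤ (∣m+n∣m⇒∣n (subst (n₁ ∣_) (sym (+-suc (n₁ * b) r)) n₁∣) (m∣m*n b)))

  -- Among a_1 … a_(n₁ q) the ones sit at the multiples n₁ t, t ≤ q, and there a_(n₁ t) = 1 - a′_t.
  ones-multiple : ∀ q → ones (n₁ * q) + ones′ q ≡ q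
  ones-multiple zero = cong (λ x → ones x + 0) (*-zeroʳ n₁)
  ones-multiple (suc q) = begin
    ones (n₁ * suc q) + ones′ (suc q)
      ≡⟨ cong₂ _+_ (cong ones n₁[1+q]) (weight-suc (U (shift ns)) 0 q) ⟩
    ones (suc (n₁ * q + pred n₁)) + (ones′ q + a (shift ns) (suc q))
      ≡⟨ cong (_+ (ones′ q + a (shift ns) (suc q))) (weight-suc (U ns) 0 (n₁ * q + pred n₁)) ⟩
    (ones (n₁ * q + pred n₁) + a ns (suc (n₁ * q + pred n₁))) + (ones′ q + a (shift ns) (suc q))
      ≡⟨ cong (_+ (ones′ q + a (shift ns) (suc q))) (cong₂ _+_ (ones-nonmultiple q (n₁∸1<n₁ radices)) (cong (a ns) (sym n₁[1+q]))) ⟩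
    (ones (n₁ * q) + a ns (n₁ * suc q)) + (ones′ q + a (shift ns) (suc q))
      ≡⟨ interchange (ones (n₁ * q)) (a ns (n₁ * suc q)) (ones′ q) _ ⟩
    (ones (n₁ * q) + ones′ q) + (a ns (n₁ * suc q) + a (shift ns) (suc q))
      ≡⟨ cong₂ _+_ (ones-multiple q) (a-multiple radices z<s) ⟩
    q + 1
      ≡⟨ +-comm q 1 ⟩
    suc q ∎
    where
      open ≡-Reasoning
      n₁[1+q] : n₁ * suc q ≡ suc (n₁ * q + pred n₁)
      n₁[1+q] = begin
        n₁ * suc q              ≡⟨ *-suc n₁ q ⟩
        n₁ + n₁ * q             ≡⟨ cong (_+ n₁ * q) (sym (suc-pred n₁ {{n₁-nonZero radices}})) ⟩
        suc (pred n₁ + n₁ * q)  ≡⟨ cong suc (+-comm (pred n₁) (n₁ * q)) ⟩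
        suc (n₁ * q + pred n₁)  ∎

  ones-shift : ∀ q {t} → t < n₁ → ones (n₁ * q + t) + ones′ q ≡ q
  ones-shift q t<n₁ = trans (cong (_+ ones′ q) (ones-nonmultiple q t<n₁)) (ones-multiple q)

  -- A factor starting at n₁ q + t and ending at n₁ (q + N) + t′ covers exactly the multiples
  -- n₁ (q + 1), …, n₁ (q + N), which correspond to the factor of length N of U (shift ns) at q.
  weight-shift : ∀ {q t n N t′} → t < n₁ → t′ < n₁ → t + n ≡ n₁ * N + t′ →
    weight (U ns) (n₁ * q + t) n + weight (U (shift ns)) q N ≡ N
  weight-shift {q} {t} {n} {N} {t′} t<n₁ t′<n₁ t+n≡ = +-cancelˡ-≡ q _ _ (begin
    q + (w + w′)                              ≡⟨ cong (_+ (w + w′)) (sym (ones-shift q t<n₁)) ⟩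
    (ones (n₁ * q + t) + ones′ q) + (w + w′)  ≡⟨ interchange (ones (n₁ * q + t)) (ones′ q) w w′ ⟩
    (ones (n₁ * q + t) + w) + (ones′ q + w′)  ≡⟨ cong₂ _+_ (sym (weight-+ (U ns) 0 (n₁ * q + t) n)) (sym (weight-+ (U (shift ns)) 0 q N)) ⟩
    ones (n₁ * q + t + n) + ones′ (q + N)     ≡⟨ cong (λ x → ones x + ones′ (q + N)) end ⟩
    ones (n₁ * (q + N) + t′) + ones′ (q + N)  ≡⟨ ones-shift (q + N) t′<n₁ ⟩
    q + N                                     ∎)
    where
      open ≡-Reasoning
      w = weight (U ns) (n₁ * q + t) n
      w′ = weight (U (shift ns)) q N
      end : n₁ * q + t + n ≡ n₁ * (q + N) + t′
      end = begin
        n₁ * q + t + n          ≡⟨ +-assoc (n₁ * q) t n ⟩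
        n₁ * q + (t + n)        ≡⟨ cong (n₁ * q +_) t+n≡ ⟩
        n₁ * q + (n₁ * N + t′)  ≡⟨ sym (+-assoc (n₁ * q) _ t′) ⟩
        n₁ * q + n₁ * N + t′    ≡⟨ cong (_+ t′) (sym (*-distribˡ-+ n₁ q N)) ⟩
        n₁ * (q + N) + t′       ∎

module _ {ns : ℕ → ℕ} (radices : Radices ns) where

  private
    n₁ = ns 1

  U[n₁∸1]≡1 : U ns (pred n₁) ≡ 1
  U[n₁∸1]≡1 = begin
    a ns (suc (pred n₁))           ≡⟨ cong (a ns) (trans (suc-pred n₁ {{n₁-nonZero radices}}) (sym (*-identityʳ n₁))) ⟩
    a ns (n₁ * 1)                  ≡⟨ sym (+-identityʳ _) ⟩
    a ns (n₁ * 1) + 0              ≡⟨ cong (a ns (n₁ * 1) +_) (sym (U[0]≡0 (Radices-shift radices))) ⟩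
    a ns (n₁ * 1) + a (shift ns) 1 ≡⟨ a-multiple radices ≤-refl ⟩
    1                              ∎
    where open ≡-Reasoning

  weight-letter-n₁∸1 : weight (U ns) (pred n₁) 1 ≡ suc (weight (U ns) 0 1)
  weight-letter-n₁∸1 = trans (weight-1 (U ns) (pred n₁))
    (trans U[n₁∸1]≡1 (cong suc (sym (trans (weight-1 (U ns) 0) (U[0]≡0 radices)))))

  weight-letter-cases : ∀ k → weight (U ns) k 1 ≡ weight (U ns) 0 1 ⊎ weight (U ns) k 1 ≡ weight (U ns) (pred n₁) 1
  weight-letter-cases k with n≤1⇒n≡0∨n≡1 (U-binary ns k)
  ... | inj₁ Uk≡0 = inj₁ (trans (weight-1 (U ns) k) (trans Uk≡0 (sym (trans (weight-1 (U ns) 0) (U[0]≡0 radices)))))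
  ... | inj₂ Uk≡1 = inj₂ (trans (weight-1 (U ns) k) (trans Uk≡1 (sym (trans (weight-1 (U ns) (pred n₁)) U[n₁∸1]≡1))))

  -- Write k = n₁ q + t: the factor of length n at k meets N or N + 1 multiples of n₁.
  weight-shift-bounds : ∀ {n N s} → n ≡ n₁ * N + s → s < n₁ → ∀ k → ∃ λ q →
    N ≤ weight (U ns) k n + weight (U (shift ns)) q N × weight (U ns) k n + weight (U (shift ns)) q N ≤ suc N
  weight-shift-bounds {n} {N} {s} refl s<n₁ k
    with q , t , t<n₁ , refl ← euclid k n₁ (0<n₁ radices)
    with e , t′ , t′<n₁ , t+s≡ ← euclid (t + s) n₁ (0<n₁ radices)
    = q , N≤ , ≤1+N
    where
      open ≤-Reasoning
      w = weight (U ns) (n₁ * q + t) (n₁ * N + s)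
      x = weight (U (shift ns)) q N
      δ = weight (U (shift ns)) (q + N) e
      e≤1 : e ≤ 1
      e≤1 = euclid-quotient-≤ n₁ t<n₁ t+s≡ (≤-trans (<⇒≤ s<n₁) (≤-reflexive (sym (*-identityʳ n₁))))
      t+n≡ : t + (n₁ * N + s) ≡ n₁ * (N + e) + t′
      t+n≡ = begin-equality
        t + (n₁ * N + s)        ≡⟨ x∙yz≈y∙xz t (n₁ * N) s ⟩
        n₁ * N + (t + s)        ≡⟨ cong (n₁ * N +_) t+s≡ ⟩
        n₁ * N + (n₁ * e + t′)  ≡⟨ sym (+-assoc (n₁ * N) _ t′) ⟩
        n₁ * N + n₁ * e + t′    ≡⟨ cong (_+ t′) (sym (*-distribˡ-+ n₁ N e)) ⟩
        n₁ * (N + e) + t′       ∎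
      w+x+δ≡ : w + x + δ ≡ N + e
      w+x+δ≡ = begin-equality
        w + x + δ                            ≡⟨ +-assoc w x δ ⟩
        w + (x + δ)                          ≡⟨ cong (w +_) (sym (weight-+ (U (shift ns)) q N e)) ⟩
        w + weight (U (shift ns)) q (N + e)  ≡⟨ weight-shift radices t<n₁ t′<n₁ t+n≡ ⟩
        N + e                                ∎
      N≤ : N ≤ w + x
      N≤ = +-cancelʳ-≤ e N (w + x) (begin
        N + e          ≡⟨ sym w+x+δ≡ ⟩
        w + x + δ      ≤⟨ +-monoʳ-≤ (w + x) (weight≤length (U-binary (shift ns)) (q + N) e) ⟩
        w + x + e      ∎)
      ≤1+N : w + x ≤ suc N
      ≤1+N = begin
        w + x          ≤⟨ m≤m+n (w + x) δ ⟩
        w + x + δ      ≡⟨ w+x+δ≡ ⟩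
        N + e          ≤⟨ +-monoʳ-≤ N e≤1 ⟩
        N + 1          ≡⟨ +-comm N 1 ⟩
        suc N          ∎

weight-shift² : ∀ {ns} → Radices ns → ∀ {Q s t n N₂ t₂ N₃ s₃} → t < ns 1 → t₂ < ns 1 → s < ns 2 → s₃ < ns 2 →
  t + n ≡ ns 1 * N₂ + t₂ → s + N₂ ≡ ns 2 * N₃ + s₃ →
  weight (U ns) (ns 1 * (ns 2 * Q + s) + t) n + N₃ ≡ N₂ + weight (U (shift (shift ns))) Q N₃
weight-shift² {ns} radices {Q} {s} {t} {n} {N₂} {t₂} {N₃} t<n₁ t₂<n₁ s<n₂ s₃<n₂ t+n≡ s+N₂≡ = begin
  w + N₃          ≡⟨ cong (w +_) (sym (weight-shift (Radices-shift radices) s<n₂ s₃<n₂ s+N₂≡)) ⟩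
  w + (w′ + w″)   ≡⟨ sym (+-assoc w w′ w″) ⟩
  w + w′ + w″     ≡⟨ cong (_+ w″) (weight-shift radices t<n₁ t₂<n₁ t+n≡) ⟩
  N₂ + w″         ∎
  where
    open ≡-Reasoning
    w = weight (U ns) (ns 1 * (ns 2 * Q + s) + t) n
    w′ = weight (U (shift ns)) (ns 2 * Q + s) N₂
    w″ = weight (U (shift (shift ns))) Q N₃

weight-m-twoValued : ∀ {ns} → Radices ns → ∀ j → TwoValued (λ k → weight (U ns) k (m ns j))
weight-m-twoValued {ns} radices zero = 0 , pred (ns 1) , weight-letter-n₁∸1 radices , weight-letter-cases radices
weight-m-twoValued {ns} radices (suc j)
  with k₀′ , k₁′ , w₁′≡1+w₀′ , two′ ← weight-m-twoValued (Radices-shift radices) j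
  = subst (λ n → TwoValued (λ k → weight (U ns) k n)) (sym (m-suc ns j)) (n₁ * k₁′ + 0 , n₁ * k₀′ + 0 , w₁≡1+w₀ , two)
  where
    n₁ = ns 1
    N = m (shift ns) j
    w : ℕ → ℕ
    w k = weight (U ns) k (n₁ * N)
    w′ : ℕ → ℕ
    w′ q = weight (U (shift ns)) q N
    complement : ∀ q {t} → t < n₁ → w (n₁ * q + t) + w′ q ≡ N
    complement q t<n₁ = weight-shift radices t<n₁ t<n₁ (+-comm _ (n₁ * N))
    w₁≡1+w₀ : w (n₁ * k₀′ + 0) ≡ suc (w (n₁ * k₁′ + 0))
    w₁≡1+w₀ = +-cancelʳ-≡ (w′ k₀′) _ _ (begin
      w (n₁ * k₀′ + 0) + w′ k₀′        ≡⟨ complement k₀′ (0<n₁ radices) ⟩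
      N                                ≡⟨ sym (complement k₁′ (0<n₁ radices)) ⟩
      w (n₁ * k₁′ + 0) + w′ k₁′        ≡⟨ cong (w (n₁ * k₁′ + 0) +_) w₁′≡1+w₀′ ⟩
      w (n₁ * k₁′ + 0) + suc (w′ k₀′)  ≡⟨ +-suc _ (w′ k₀′) ⟩
      suc (w (n₁ * k₁′ + 0)) + w′ k₀′  ∎)
      where open ≡-Reasoning
    two : ∀ k → w k ≡ w (n₁ * k₁′ + 0) ⊎ w k ≡ w (n₁ * k₀′ + 0)
    two k with q , t , t<n₁ , refl ← euclid k n₁ (0<n₁ radices) with two′ q
    ... | inj₁ w′q≡w′₀ = inj₂ (complements-equal (complement q t<n₁) (complement k₀′ (0<n₁ radices)) w′q≡w′₀)
    ... | inj₂ w′q≡w′₁ = inj₁ (complements-equal (complement q t<n₁) (complement k₁′ (0<n₁ radices)) w′q≡w′₁)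

abelianComplexity-m : ∀ {ns} → Radices ns → ∀ j → AbelianComplexity (U ns) (m ns j) 2
abelianComplexity-m {ns} radices j = abelianComplexity-twoValued (U-binary ns) (m ns j) (weight-m-twoValued radices j)

attained-below : ∀ {ns} → Radices ns → ∀ L {n} → n ≤ m ns L → ∀ k →
  ∃ λ k′ → k′ < m ns (suc L) × weight (U ns) k′ n ≡ weight (U ns) k n
attained-below radices zero {zero} _ k = 0 , 0<m radices 1 , refl
attained-below {ns} radices zero {1} _ k =
  [ (λ w≡w₀ → 0 , 0<m radices 1 , sym w≡w₀) ,
    (λ w≡w₁ → pred (ns 1) , subst (pred (ns 1) <_) (sym (+-identityʳ (ns 1))) (n₁∸1<n₁ radices) , sym w≡w₁) ]′
  (weight-letter-cases radices k)
attained-below radices zero {2+ _} (s≤s ())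
attained-below {ns} radices (suc L) {n} n≤m k
  with q , t , t<n₁ , refl ← euclid k (ns 1) (0<n₁ radices)
  with N , t′ , t′<n₁ , t+n≡ ← euclid (t + n) (ns 1) (0<n₁ radices)
  with q′ , q′<m′ , w′q′≡w′q ← attained-below (Radices-shift radices) L
         (euclid-quotient-≤ (ns 1) t<n₁ t+n≡ (≤-trans n≤m (≤-reflexive (m-suc ns L)))) q
  = ns 1 * q′ + t ,
    subst (ns 1 * q′ + t <_) (sym (m-suc ns (suc L))) (euclid-< (ns 1) t<n₁ q′<m′) ,
    complements-equal (weight-shift radices t<n₁ t′<n₁ t+n≡) (weight-shift radices t<n₁ t′<n₁ t+n≡) w′q′≡w′q

weights-within : ∀ {ns} → Radices ns → ∀ L {n} → n ≤ m ns (suc L) → ValuesWithin (λ k → weight (U ns) k n) (suc L)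
weights-within {ns} radices zero {n} n≤m = 1 , λ k → weight≤1 k , m≤n+m 1 _
  where
    weight≤1 : ∀ k → weight (U ns) k n ≤ 1
    weight≤1 k
      with q , t , t<n₁ , refl ← euclid k (ns 1) (0<n₁ radices)
      with N , t′ , t′<n₁ , t+n≡ ← euclid (t + n) (ns 1) (0<n₁ radices)
      = begin
        weight (U ns) (ns 1 * q + t) n                                ≤⟨ m≤m+n _ _ ⟩
        weight (U ns) (ns 1 * q + t) n + weight (U (shift ns)) q N    ≡⟨ weight-shift radices t<n₁ t′<n₁ t+n≡ ⟩
        N                                                             ≤⟨ euclid-quotient-≤ (ns 1) t<n₁ t+n≡ (≤-trans n≤m (≤-reflexive (m-suc ns 0))) ⟩
        1                                                             ∎
      where open ≤-Reasoning
weights-within {ns} radices (suc L) {n} n≤m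
  with N , s , s<n₁ , n≡ ← euclid n (ns 1) (0<n₁ radices)
  with c′ , within′ ← weights-within (Radices-shift radices) L
         (euclid-quotient-≤ (ns 1) (0<n₁ radices) n≡ (≤-trans n≤m (≤-reflexive (m-suc ns (suc L)))))
  = (suc N + suc L) ∸ c′ , λ k →
    let (q , lo , hi) = weight-shift-bounds radices n≡ s<n₁ k in
    complement-within (proj₁ (within′ q)) (proj₂ (within′ q)) lo hi

weight-classes : ∀ {ns} → Radices ns → ∀ L {n} → n ≤ m ns L →
  ∃ λ C → Distinct (λ k → weight (U ns) k n) C × Covers (λ k → weight (U ns) k n) C
weight-classes {ns} radices L n≤m = representatives _ (m ns (suc L)) (attained-below radices L n≤m)

abelianComplexity-upper : ∀ {ns} → Radices ns → ∀ L {n} → n ≤ m ns (suc L) →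
  ∃ λ c → AbelianComplexity (U ns) n c × c ≤ suc L + 1
abelianComplexity-upper {ns} radices L {n} n≤m
  with C , distinct , covers ← weight-classes radices (suc L) n≤m
  = length C , abelianComplexity-weight (U-binary ns) n distinct covers ,
    ≤-trans (length≤-within _ (suc L) (weights-within radices L n≤m) distinct) (≤-reflexive (+-comm 1 (suc L)))

-- Writing S ns (1 + J) = n₁ X, the factors of length 2 n₁ X (+ 1) at n₁ n₂ Q (+ n₁ - 1) project,
-- through two shifts, onto the factor of length 2 S (shift² ns) J + 1 at Q, which carries the spread.
module SpreadLift {ns : ℕ → ℕ} (radices : Radices ns) (J : ℕ) where

  private
    n₁ = ns 1
    n₂ = ns 2
    ns″ = shift (shift ns)
    X = pred n₂ + n₂ * S ns″ J
    N₃ = 2 * S ns″ J + 1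
    w : ℕ → ℕ → ℕ
    w = weight (U ns)
    w″ : ℕ → ℕ
    w″ Q = weight (U ns″) Q N₃

    at-multiple : ∀ Q {e} → e < n₁ → w (n₁ * (n₂ * Q + 0) + 0) (2 * (n₁ * X) + e) + N₃ ≡ 2 * X + w″ Q
    at-multiple Q {e} e<n₁ = weight-shift² radices (0<n₁ radices) e<n₁ (0<n₁ (Radices-shift radices))
      (≤-<-trans (∸-monoʳ-≤ n₂ (n≤1+n 1)) (n₁∸1<n₁ (Radices-shift radices)))
      (identity n₁ X e) (double-pred n₂ (S ns″ J) (1<n₁ (Radices-shift radices)))
      where
        identity : ∀ n₁ X e → 2 * (n₁ * X) + e ≡ n₁ * (2 * X) + e
        identity = solve-∀

    before-multiple : ∀ Q → w (n₁ * (n₂ * Q + 0) + pred n₁) (2 * (n₁ * X) + 1) + N₃ ≡ suc (2 * X) + w″ Q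
    before-multiple Q = weight-shift² radices (n₁∸1<n₁ radices) (0<n₁ radices) (0<n₁ (Radices-shift radices))
      (n₁∸1<n₁ (Radices-shift radices))
      (pred-+-double n₁ X (0<n₁ radices)) (suc-double-pred n₂ (S ns″ J) (0<n₁ (Radices-shift radices)))

    length≡ : ∀ e → 2 * S ns (suc J) + e ≡ 2 * (n₁ * X) + e
    length≡ e = cong (λ s → 2 * s + e) (S-shift² ns J)

  lift-even : ∀ {d} → Spread w″ d → Spread (λ k → w k (2 * S ns (suc J))) d
  lift-even {d} (Q₁ , Q₂ , spread) =
    subst (λ n → Spread (λ k → w k n) d) (trans (sym (length≡ 0)) (+-identityʳ _))
      (n₁ * (n₂ * Q₁ + 0) + 0 , n₁ * (n₂ * Q₂ + 0) + 0 ,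
       spread-transfer {A = 2 * X} {e = 0} (at-multiple Q₁ (0<n₁ radices)) (at-multiple Q₂ (0<n₁ radices))
         (≤-reflexive (+-identityʳ _)) spread)

  lift-odd : ∀ {d} → Spread w″ d → Spread (λ k → w k (2 * S ns (suc J) + 1)) (suc d)
  lift-odd {d} (Q₁ , Q₂ , spread) =
    subst (λ n → Spread (λ k → w k n) (suc d)) (sym (length≡ 1))
      (n₁ * (n₂ * Q₁ + 0) + 0 , n₁ * (n₂ * Q₂ + 0) + pred n₁ ,
       spread-transfer {A = 2 * X} {e = 1} (at-multiple Q₁ (1<n₁ radices)) (before-multiple Q₂) (≤-reflexive (+-comm _ 1)) spread)

spread-odd : ∀ {ns} → Radices ns → ∀ J → Spread (λ k → weight (U ns) k (2 * S ns J + 1)) (suc J)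
spread-odd {ns} radices zero = 0 , pred (ns 1) , ≤-reflexive (trans (+-comm _ 1) (sym (weight-letter-n₁∸1 radices)))
spread-odd radices (suc J) = SpreadLift.lift-odd radices J (spread-odd (Radices-shift (Radices-shift radices)) J)

spread-even : ∀ {ns} → Radices ns → ∀ J → Spread (λ k → weight (U ns) k (2 * S ns (suc J))) (suc J)
spread-even radices J = SpreadLift.lift-even radices J (spread-odd (Radices-shift (Radices-shift radices)) J)

abelianComplexity-lower : ∀ {ns} → Radices ns → ∀ J L → m ns L < 2 * S ns (suc J) → 2 * S ns (suc J) ≤ m ns (suc L) →
  ∃ λ c → AbelianComplexity (U ns) (2 * S ns (suc J)) c × suc L + 1 ≤ 2 * c
abelianComplexity-lower {ns} radices J L m<n n≤m
  with C , distinct , covers ← weight-classes radices (suc L) n≤m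
  = length C , abelianComplexity-weight (U-binary ns) n distinct covers , (begin
    suc L + 1           ≡⟨ +-comm (suc L) 1 ⟩
    2 + L               ≤⟨ +-monoʳ-≤ 2 (m[L]<2*S[J]⇒L≤2*J radices (suc J) L m<n) ⟩
    2 + 2 * suc J       ≡⟨ sym (*-suc 2 (suc J)) ⟩
    2 * (2 + J)         ≤⟨ *-monoʳ-≤ 2 (length≥-spread (U-binary ns) n covers (spread-even radices J)) ⟩
    2 * length C        ∎)
  where
    open ≤-Reasoning
    n = 2 * S ns (suc J)

lemma12 : (ns : ℕ → ℕ) → (∀ j → 1 ≤ j → 2 ≤ ns j) →
    ((n n' : ℕ) → 1 ≤ n → 1 ≤ n' → m ns (n' ∸ 1) < n → n ≤ m ns n' →
      ∃ λ c → AbelianComplexity (U ns) n c × c ≤ n' + 1)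
    × ((J n n' : ℕ) → 1 ≤ J → n ≡ 2 * S ns J → 1 ≤ n' →
      m ns (n' ∸ 1) < n → n ≤ m ns n' →
      ∃ λ c → AbelianComplexity (U ns) n c × n' + 1 ≤ 2 * c)
    × ((j : ℕ) → 1 ≤ j → AbelianComplexity (U ns) (m ns j) 2)
lemma12 ns radices =
  (λ { _ (suc L) _ _ _ n≤m → abelianComplexity-upper radices L n≤m }) ,
  (λ { (suc J) _ (suc L) _ refl _ m<n n≤m → abelianComplexity-lower radices J L m<n n≤m }) ,
  λ j _ → abelianComplexity-m radices j
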